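{- For every finite simple graph $G$, the s-homotopy type and the ws-homotopy type of $G$ coincide: $[G]_s=[G]_{ws}$, i.e. a graph $H$ has the same s-homotopy type as $G$ if and only if it has the same ws-homotopy type as $G$.
   Context: Graphs are finite, undirected, without loops or multiple edges, considered up to isomorphism. $N_G(g)$ is the set of neighbours, $N_G[g]=N_G(g)\cup\{g\}$; vertex sets are identified with induced subgraphs. $g$ is dominated by $g'\ne g$ if $N_G[g]\subseteq N_G[g']$; a graph is dismantlable if it has one vertex or its vertices can be listed $g_1,\dots,g_n$ with each $g_i$ ($2\le i\le n$) dominated by another vertex in the subgraph induced by $\{g_1,\dots,g_i\}$. A vertex $g$ is s-dismantlable if $N_G(g)$ is dismantlable. An edge $gg'$ is s-dismantlable if $N_G(g)\cap N_G(g')$ is nonempty and (as an induced subgraph) dismantlable. $G,H$ have the same s-homotopy type if one can be transformed into the other by finitely many deletions/additions of s-dismantlable vertices (an added vertex must be s-dismantlable in the enlarged graph). $G,H$ have the same ws-homotopy type if one can be transformed into the other by finitely many steps, each of which is the deletion or addition of an s-dismantlable vertex, or the deletion or addition of an s-dismantlable edge (an added vertex/edge must be s-dismantlable in the enlarged graph). -}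

module Defs where

open import Data.Nat using (ℕ; zero; suc)
open import Data.Bool using (Bool; true; false; _∧_; _∨_; not)
open import Data.Bool.Properties using (∧-comm; ∨-comm)
open import Data.Fin using (Fin; zero; suc; _≟_)
open import Data.Vec using (Vec; []; _∷_; tabulate)
open import Data.Product using (Σ; _×_; _,_; ∃)
open import Data.Sum using (_⊎_)
open import Relation.Nullary using (¬_)
open import Relation.Nullary.Decidable using (⌊_⌋)
open import Relation.Binary.PropositionalEquality using (_≡_; refl; cong₂; trans)
open import Relation.Binary.Construct.Closure.Equivalence using (EqClosure)
open import Function.Bundles using (_↔_; Inverse)

record Graph : Set where
  field
    size  : ℕ
    adj   : Fin size → Fin size → Bool
    sym   : ∀ i j → adj i j ≡ adj j i
    irrefl : ∀ i → adj i i ≡ false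
open Graph public

V : Graph → Set
V G = Fin (size G)

record _≅_ (G H : Graph) : Set where
  field
    bij      : V G ↔ V H
    preserve : ∀ i j → adj H (Inverse.to bij i) (Inverse.to bij j) ≡ adj G i j

count : ∀ {n} → Vec Bool n → ℕ
count []          = 0
count (true ∷ s)  = suc (count s)
count (false ∷ s) = count s

embed : ∀ {n} (s : Vec Bool n) → Fin (count s) → Fin n
embed []          ()
embed (true ∷ s)  zero    = zero
embed (true ∷ s)  (suc i) = suc (embed s i)
embed (false ∷ s) i       = suc (embed s i)

induced : (G : Graph) → Vec Bool (size G) → Graph
induced G s = record
  { size   = count s
  ; adj    = λ i j → adj G (embed s i) (embed s j)
  ; sym    = λ i j → sym G (embed s i) (embed s j)
  ; irrefl = λ i → irrefl G (embed s i)
  }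

N : (G : Graph) → V G → Graph
N G g = induced G (tabulate (adj G g))

N∩ : (G : Graph) → V G → V G → Graph
N∩ G g g' = induced G (tabulate (λ u → adj G g u ∧ adj G g' u))

_∖_ : (G : Graph) → V G → Graph
G ∖ g = induced G (tabulate (λ u → not ⌊ u ≟ g ⌋))

InClosedN : (G : Graph) → V G → V G → Set
InClosedN G g u = (u ≡ g) ⊎ (adj G g u ≡ true)

DominatedBy : (G : Graph) → V G → V G → Set
DominatedBy G g g' = ¬ (g ≡ g') × (∀ u → InClosedN G g u → InClosedN G g' u)

-- G has one vertex, or some vertex g_n is dominated in G and G - g_n is
-- dismantlable (the inductive unfolding of the ordering g_1,…,g_n).
data Dismantlable : Graph → Set where
  single : ∀ {G} → size G ≡ 1 → Dismantlable G
  remove : ∀ {G} (g g' : V G) → DominatedBy G g g' →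
           Dismantlable (G ∖ g) → Dismantlable G

SDismVertex : (G : Graph) → V G → Set
SDismVertex G g = Dismantlable (N G g)

SDismEdge : (G : Graph) → V G → V G → Set
SDismEdge G g g' =
  adj G g g' ≡ true × ¬ (size (N∩ G g g') ≡ 0) × Dismantlable (N∩ G g g')

isPair : ∀ {n} → Fin n → Fin n → Fin n → Fin n → Bool
isPair g h i j = (⌊ i ≟ g ⌋ ∧ ⌊ j ≟ h ⌋) ∨ (⌊ i ≟ h ⌋ ∧ ⌊ j ≟ g ⌋)

isPair-sym : ∀ {n} (g h i j : Fin n) → isPair g h i j ≡ isPair g h j i
isPair-sym g h i j =
  trans (∨-comm (⌊ i ≟ g ⌋ ∧ ⌊ j ≟ h ⌋) (⌊ i ≟ h ⌋ ∧ ⌊ j ≟ g ⌋))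
        (cong₂ _∨_ (∧-comm ⌊ i ≟ h ⌋ ⌊ j ≟ g ⌋) (∧-comm ⌊ i ≟ g ⌋ ⌊ j ≟ h ⌋))

deleteEdge : (G : Graph) → V G → V G → Graph
deleteEdge G g h = record
  { size   = size G
  ; adj    = λ i j → adj G i j ∧ not (isPair g h i j)
  ; sym    = λ i j → cong₂ (λ a b → a ∧ not b) (sym G i j) (isPair-sym g h i j)
  ; irrefl = irr
  }
  where
  irr : ∀ i → adj G i i ∧ not (isPair g h i i) ≡ false
  irr i rewrite irrefl G i = refl

-- Elementary moves (additions are the symmetric counterparts of
-- deletions, handled by the equivalence closure).

VertexDel : Graph → Graph → Set
VertexDel G H = Σ (V G) λ g → SDismVertex G g × ((G ∖ g) ≅ H)

EdgeDel : Graph → Graph → Set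
EdgeDel G H = Σ (V G) λ g → Σ (V G) λ g' →
  SDismEdge G g g' × (deleteEdge G g g' ≅ H)

SMove : Graph → Graph → Set
SMove G H = (G ≅ H) ⊎ VertexDel G H

WSMove : Graph → Graph → Set
WSMove G H = (G ≅ H) ⊎ VertexDel G H ⊎ EdgeDel G H

SameS : Graph → Graph → Set
SameS = EqClosure SMove

SameWS : Graph → Graph → Set
SameWS = EqClosure WSMove

-- Deleting an s-dismantlable edge gg' is a composite of two s-moves. First add a vertex v
-- with N(v) = N[g] ∖ {g'}; this neighbourhood is a cone with apex g, so v is s-dismantlable.
-- In the enlarged graph N(g) = {v} ∪ N_G(g), and v dominates every vertex of it outside the
-- suspension of N(g) ∩ N(g') with poles v and g'; that suspension is dismantlable because
-- N(g) ∩ N(g') is. Hence g is s-dismantlable, and deleting it leaves G without the edge gg',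
-- with v in the role of g. Conversely every s-move is a ws-move.

module Submission where

open import Defs
open import Data.Bool using (Bool; true; false; _∧_; _∨_; not)
open import Data.Bool.Properties using (∧-zeroʳ; ∧-identityʳ; ∨-zeroʳ; ∨-identityʳ; not-injective)
open import Data.Empty using (⊥-elim)
open import Data.Fin using (Fin; zero; suc; _≟_)
open import Data.Fin.Properties using (suc-injective)
open import Data.List as List using (List; []; _∷_; allFin)
open import Data.Nat using (zero; suc)
open import Data.Product using (Σ; _×_; _,_; proj₁; proj₂)
open import Data.Sum using (_⊎_; inj₁; inj₂)
open import Data.Vec using (Vec; []; _∷_; tabulate; lookup)
open import Data.Vec.Properties using (lookup∘tabulate)
open import Function using (_∘_; id)
open import Function.Bundles using (mk↔ₛ′)
open import Function.Properties.Inverse using (↔-trans)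
open import Relation.Binary.Core using (_⇒_)
open import Relation.Binary.Construct.Closure.ReflexiveTransitive using (ε; _◅_)
open import Relation.Binary.Construct.Closure.Symmetric using (SymClosure; fwd; bwd)
import Relation.Binary.Construct.Closure.Equivalence as EqClosure
open import Relation.Nullary using (yes; no)
open import Relation.Nullary.Decidable using (⌊_⌋; isYes≗does; dec-true; dec-false)
open import Relation.Binary.PropositionalEquality
  using (_≡_; _≢_; _≗_; refl; cong; cong₂; trans) renaming (sym to ≡-sym)

true≢false : true ≢ false
true≢false ()

∧-true⁻ : ∀ {a b} → a ∧ b ≡ true → a ≡ true × b ≡ true
∧-true⁻ {true} b≡true = refl , b≡true

∨-true⁻ : ∀ {a b} → a ∨ b ≡ true → a ≡ true ⊎ b ≡ true
∨-true⁻ {true}  _       = inj₁ refl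
∨-true⁻ {false} b≡true = inj₂ b≡true

∨-introˡ : ∀ {a b} → a ≡ true → a ∨ b ≡ true
∨-introˡ refl = refl

∨-introʳ : ∀ {a b} → b ≡ true → a ∨ b ≡ true
∨-introʳ {a} refl = ∨-zeroʳ a

≟-≡ : ∀ {n} {u v : Fin n} → u ≡ v → ⌊ u ≟ v ⌋ ≡ true
≟-≡ {u = u} {v} u≡v = trans (isYes≗does (u ≟ v)) (dec-true (u ≟ v) u≡v)

≟-refl : ∀ {n} (u : Fin n) → ⌊ u ≟ u ⌋ ≡ true
≟-refl u = ≟-≡ refl

≟-≢ : ∀ {n} {u v : Fin n} → u ≢ v → ⌊ u ≟ v ⌋ ≡ false
≟-≢ {u = u} {v} u≢v = trans (isYes≗does (u ≟ v)) (dec-false (u ≟ v) u≢v)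

≟-sound : ∀ {n} {u v : Fin n} → ⌊ u ≟ v ⌋ ≡ true → u ≡ v
≟-sound {u = u} {v} p with u ≟ v
... | yes u≡v = u≡v

≟-suc : ∀ {n} (u v : Fin n) → ⌊ suc u ≟ suc v ⌋ ≡ ⌊ u ≟ v ⌋
≟-suc u v = trans (isYes≗does (suc u ≟ suc v)) (≡-sym (isYes≗does (u ≟ v)))

_─_ : ∀ {n} → (Fin n → Bool) → Fin n → Fin n → Bool
(P ─ g) u = P u ∧ not ⌊ u ≟ g ⌋

─-intro : ∀ {n} (P : Fin n → Bool) {g u} → P u ≡ true → u ≢ g → (P ─ g) u ≡ true
─-intro P u∈P u≢g rewrite u∈P = cong not (≟-≢ u≢g)

─-elim : ∀ {n} (P : Fin n → Bool) g {u} → (P ─ g) u ≡ true → P u ≡ true × u ≢ g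
─-elim P g {u} p with ∧-true⁻ {P u} p
... | u∈P , u≉g = u∈P , λ u≡g → true≢false (trans (≡-sym (≟-≡ u≡g)) (not-injective u≉g))

-- Induced subgraphs

embed-injective : ∀ {n} (s : Vec Bool n) i j → embed s i ≡ embed s j → i ≡ j
embed-injective (true ∷ s)  zero    zero    _ = refl
embed-injective (true ∷ s)  (suc i) (suc j) e = cong suc (embed-injective s i j (suc-injective e))
embed-injective (false ∷ s) i       j       e = embed-injective s i j (suc-injective e)

embed-∈ : ∀ {n} (s : Vec Bool n) i → lookup s (embed s i) ≡ true
embed-∈ (true ∷ s)  zero    = refl
embed-∈ (true ∷ s)  (suc i) = embed-∈ s i
embed-∈ (false ∷ s) i       = embed-∈ s i

embed-onto : ∀ {n} (s : Vec Bool n) x → lookup s x ≡ true → Σ (Fin (count s)) λ i → embed s i ≡ x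
embed-onto (true ∷ s)  zero    _ = zero , refl
embed-onto (true ∷ s)  (suc x) p with embed-onto s x p
... | i , eᵢ≡x = suc i , cong suc eᵢ≡x
embed-onto (false ∷ s) (suc x) p with embed-onto s x p
... | i , eᵢ≡x = i , cong suc eᵢ≡x

record InducedOn (H G : Graph) (P : V G → Bool) : Set where
  field
    ι           : V H → V G
    ι-injective : ∀ i j → ι i ≡ ι j → i ≡ j
    ι-adj       : ∀ i j → adj H i j ≡ adj G (ι i) (ι j)
    ι-∈         : ∀ i → P (ι i) ≡ true
    ι-onto      : ∀ x → P x ≡ true → Σ (V H) λ i → ι i ≡ x

induced-InducedOn : (G : Graph) (P : V G → Bool) → InducedOn (induced G (tabulate P)) G P
induced-InducedOn G P = record
  { ι           = embed s
  ; ι-injective = embed-injective s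
  ; ι-adj       = λ _ _ → refl
  ; ι-∈         = λ i → trans (≡-sym (lookup∘tabulate P (embed s i))) (embed-∈ s i)
  ; ι-onto      = λ x x∈P → embed-onto s x (trans (lookup∘tabulate P x) x∈P)
  }
  where
  s : Vec Bool (size G)
  s = tabulate P

InducedOn-∖ : ∀ {H G P} (E : InducedOn H G P) (i : V H) → InducedOn (H ∖ i) G (P ─ InducedOn.ι E i)
InducedOn-∖ {H} {G} {P} E i = record
  { ι           = ι ∘ κ
  ; ι-injective = λ a b e → K.ι-injective a b (ι-injective _ _ e)
  ; ι-adj       = λ a b → ι-adj (κ a) (κ b)
  ; ι-∈         = λ a → ─-intro P (ι-∈ (κ a)) (λ e → proj₂ (─-elim _ i (K.ι-∈ a)) (ι-injective _ _ e))
  ; ι-onto      = onto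
  }
  where
  open InducedOn E
  K : InducedOn (H ∖ i) H ((λ _ → true) ─ i)
  K = induced-InducedOn H ((λ _ → true) ─ i)
  module K = InducedOn K
  κ : V (H ∖ i) → V H
  κ = K.ι
  onto : ∀ x → (P ─ ι i) x ≡ true → Σ (V (H ∖ i)) λ a → ι (κ a) ≡ x
  onto x p with ─-elim P (ι i) p
  ... | x∈P , x≢ιi with ι-onto x x∈P
  ...   | j , refl with K.ι-onto j (─-intro (λ _ → true) refl (λ j≡i → x≢ιi (cong ι j≡i)))
  ...     | a , refl = a , refl

-- Dismantlable vertex sets

DominatedWithin : (G : Graph) → (V G → Bool) → V G → V G → Set
DominatedWithin G P g g' = ∀ u → P u ≡ true → InClosedN G g u → InClosedN G g' u

-- Dismantlability of the subgraph induced on P, stated inside the ambient graph so that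
-- deleting a vertex does not re-index the remaining ones.
data DismantlableSet (G : Graph) : (V G → Bool) → Set where
  single : ∀ {P} a → P a ≡ true → (∀ u → P u ≡ true → u ≡ a) → DismantlableSet G P
  remove : ∀ {P} g g' → P g ≡ true → P g' ≡ true → g ≢ g' → DominatedWithin G P g g' →
           DismantlableSet G (P ─ g) → DismantlableSet G P

DismantlableSet-cong : ∀ {G P Q} → P ≗ Q → DismantlableSet G P → DismantlableSet G Q
DismantlableSet-cong P≗Q (single a a∈P only-a) =
  single a (trans (≡-sym (P≗Q a)) a∈P) (λ u u∈Q → only-a u (trans (P≗Q u) u∈Q))
DismantlableSet-cong P≗Q (remove g g' g∈P g'∈P g≢g' dom D) =
  remove g g' (trans (≡-sym (P≗Q g)) g∈P) (trans (≡-sym (P≗Q g')) g'∈P) g≢g'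
         (λ u u∈Q → dom u (trans (P≗Q u) u∈Q))
         (DismantlableSet-cong (λ u → cong (λ b → b ∧ not ⌊ u ≟ g ⌋) (P≗Q u)) D)

private
  size≡1 : ∀ {n} → Fin n → (∀ (i j : Fin n) → i ≡ j) → n ≡ 1
  size≡1 {suc zero}    _ _   = refl
  size≡1 {suc (suc n)} _ all with all zero (suc zero)
  ... | ()

  the-vertex : ∀ {n} → n ≡ 1 → Fin n
  the-vertex refl = zero

  unique-vertex : ∀ {n} → n ≡ 1 → (i j : Fin n) → i ≡ j
  unique-vertex refl zero zero = refl

module _ {H G : Graph} {P : V G → Bool} (E : InducedOn H G P) where
  open InducedOn E

  ι-closed : ∀ {i u} → InClosedN H i u → InClosedN G (ι i) (ι u)
  ι-closed (inj₁ u≡i) = inj₁ (cong ι u≡i)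
  ι-closed {i} {u} (inj₂ i~u) = inj₂ (trans (≡-sym (ι-adj i u)) i~u)

  ι-closed⁻ : ∀ {i u} → InClosedN G (ι i) (ι u) → InClosedN H i u
  ι-closed⁻ (inj₁ e) = inj₁ (ι-injective _ _ e)
  ι-closed⁻ {i} {u} (inj₂ i~u) = inj₂ (trans (ι-adj i u) i~u)

dismantlable⇒set : ∀ {H G P} → Dismantlable H → InducedOn H G P → DismantlableSet G P
dismantlable⇒set {P = P} (single size≡1) E =
  single (ι (the-vertex size≡1)) (ι-∈ _) only
  where
  open InducedOn E
  only : ∀ u → P u ≡ true → u ≡ ι (the-vertex size≡1)
  only u u∈P with ι-onto u u∈P
  ... | i , refl = cong ι (unique-vertex size≡1 i _)
dismantlable⇒set {G = G} {P} (remove g g' (g≢g' , dom) D) E =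
  remove (ι g) (ι g') (ι-∈ g) (ι-∈ g') (λ e → g≢g' (ι-injective _ _ e)) dom-ι
         (dismantlable⇒set D (InducedOn-∖ E g))
  where
  open InducedOn E
  dom-ι : DominatedWithin G P (ι g) (ι g')
  dom-ι u u∈P c with ι-onto u u∈P
  ... | i , refl = ι-closed E (dom i (ι-closed⁻ E c))

set⇒dismantlable : ∀ {G P} → DismantlableSet G P → ∀ {H} → InducedOn H G P → Dismantlable H
set⇒dismantlable (single a a∈P only-a) E =
  single (size≡1 (proj₁ (ι-onto a a∈P)) λ i j → ι-injective i j (trans (only-a _ (ι-∈ i)) (≡-sym (only-a _ (ι-∈ j)))))
  where open InducedOn E
set⇒dismantlable (remove g g' g∈P g'∈P g≢g' dom D) E with InducedOn.ι-onto E g g∈P | InducedOn.ι-onto E g' g'∈P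
... | i , refl | i' , refl =
  remove i i' ((λ e → g≢g' (cong ι e)) , λ u c → ι-closed⁻ E (dom (ι u) (ι-∈ u) (ι-closed E c)))
         (set⇒dismantlable D (InducedOn-∖ E i))
  where open InducedOn E

_∈ᵇ_ : ∀ {n} → Fin n → List (Fin n) → Bool
u ∈ᵇ []       = false
u ∈ᵇ (x ∷ xs) = ⌊ u ≟ x ⌋ ∨ u ∈ᵇ xs

∈ᵇ-tabulate : ∀ {m n} (f : Fin m → Fin n) i → f i ∈ᵇ List.tabulate f ≡ true
∈ᵇ-tabulate f zero    = ∨-introˡ (≟-refl (f zero))
∈ᵇ-tabulate f (suc i) = ∨-introʳ (∈ᵇ-tabulate (f ∘ suc) i)

∈ᵇ-allFin : ∀ {n} (u : Fin n) → u ∈ᵇ allFin n ≡ true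
∈ᵇ-allFin = ∈ᵇ-tabulate id

absorb-dominated : ∀ {G} {B P : V G → Bool} (a : V G) → B a ≡ true → (∀ u → B u ≡ true → P u ≡ true) →
                   (∀ u → P u ≡ true → B u ≡ false → DominatedWithin G P u a) →
                   DismantlableSet G B → DismantlableSet G P
absorb-dominated {G} {B} {P} a a∈B B⊆P dom D = DismantlableSet-cong grown (grow (allFin _))
  where
  -- Vertices of P are put back one at a time; each one outside B is dominated by a at that
  -- moment already, since domination within P persists in every subset of P.
  Grow : List (V G) → V G → Bool
  Grow xs u = B u ∨ (P u ∧ u ∈ᵇ xs)

  Grow⊆P : ∀ xs u → Grow xs u ≡ true → P u ≡ true
  Grow⊆P xs u p with ∨-true⁻ p
  ... | inj₁ u∈B = B⊆P u u∈B
  ... | inj₂ q   = proj₁ (∧-true⁻ q)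

  grown : Grow (allFin _) ≗ P
  grown u rewrite ∈ᵇ-allFin u | ∧-identityʳ (P u) with B u in u∈B
  ... | true  = ≡-sym (B⊆P u u∈B)
  ... | false = refl

  unchanged : ∀ v xs → P v ≡ false ⊎ Grow xs v ≡ true → Grow xs ≗ Grow (v ∷ xs)
  unchanged v xs _ u with u ≟ v
  unchanged v xs _          u | no _ = refl
  unchanged v xs (inj₁ v∉P) u | yes refl rewrite v∉P = refl
  unchanged v xs (inj₂ v∈Grow) u | yes refl =
    trans v∈Grow (≡-sym (∨-introʳ (trans (∧-identityʳ (P u)) (Grow⊆P xs u v∈Grow))))

  grow : ∀ xs → DismantlableSet G (Grow xs)
  grow [] = DismantlableSet-cong (λ u → ≡-sym (trans (cong (B u ∨_) (∧-zeroʳ (P u))) (∨-identityʳ (B u)))) D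
  grow (v ∷ xs) with P v in v∈P
  ... | false = DismantlableSet-cong (unchanged v xs (inj₁ v∈P)) (grow xs)
  ... | true with Grow xs v in v-grown
  ...   | true  = DismantlableSet-cong (unchanged v xs (inj₂ v-grown)) (grow xs)
  ...   | false =
    remove v a v∈Grow (∨-introˡ a∈B) v≢a (λ u p → dom v v∈P v∉B u (Grow⊆P (v ∷ xs) u p))
           (DismantlableSet-cong removed (grow xs))
    where
    v∉B : B v ≡ false
    v∉B with B v
    ... | false = refl
    ... | true  = ⊥-elim (true≢false v-grown)
    v≢a : v ≢ a
    v≢a refl = true≢false (trans (≡-sym (∨-introˡ a∈B)) v-grown)
    v∈Grow : Grow (v ∷ xs) v ≡ true
    v∈Grow = ∨-introʳ (trans (cong (_∧ _) v∈P) (∨-introˡ (≟-refl v)))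
    removed : Grow xs ≗ (Grow (v ∷ xs) ─ v)
    removed u with u ≟ v
    ... | no _     = ≡-sym (∧-identityʳ _)
    ... | yes refl = trans v-grown (≡-sym (∧-zeroʳ _))

cone-dismantlable : ∀ {G P} (a : V G) → P a ≡ true → (∀ u → P u ≡ true → u ≢ a → adj G a u ≡ true) →
                    DismantlableSet G P
cone-dismantlable {G} {P} a a∈P apex =
  absorb-dominated {B = λ u → ⌊ u ≟ a ⌋} a (≟-refl a) a⊆P a-dominates (single a (≟-refl a) λ _ → ≟-sound)
  where
  a⊆P : ∀ u → ⌊ u ≟ a ⌋ ≡ true → P u ≡ true
  a⊆P u u≡a rewrite ≟-sound u≡a = a∈P
  a-dominates : ∀ u → P u ≡ true → ⌊ u ≟ a ⌋ ≡ false → DominatedWithin G P u a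
  a-dominates _ _ _ w w∈P _ with w ≟ a
  ... | yes w≡a = inj₁ w≡a
  ... | no w≢a  = inj₂ (apex w w∈P w≢a)

join-dismantlable : ∀ {G} {Q X : V G → Bool} → DismantlableSet G Q →
                    (∀ u v → Q u ≡ true → X v ≡ true → adj G u v ≡ true) →
                    DismantlableSet G (λ u → Q u ∨ X u)
join-dismantlable {G} {Q} {X} (single a a∈Q only-a) complete = cone-dismantlable a (∨-introˡ a∈Q) apex
  where
  apex : ∀ u → Q u ∨ X u ≡ true → u ≢ a → adj G a u ≡ true
  apex u p u≢a with ∨-true⁻ p
  ... | inj₁ u∈Q = ⊥-elim (u≢a (only-a u u∈Q))
  ... | inj₂ u∈X = complete a u a∈Q u∈X
join-dismantlable {G} {Q} {X} (remove g g' g∈Q g'∈Q g≢g' dom D) complete =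
  remove g g' (∨-introˡ g∈Q) (∨-introˡ g'∈Q) g≢g' dom-join
         (DismantlableSet-cong reorder (join-dismantlable D λ u v p → complete u v (proj₁ (─-elim Q g p))))
  where
  dom-join : DominatedWithin G (λ u → Q u ∨ X u) g g'
  dom-join u p c with ∨-true⁻ p
  ... | inj₁ u∈Q = dom u u∈Q c
  ... | inj₂ u∈X = inj₂ (complete g' u g'∈Q u∈X)
  g∉X : X g ≡ false
  g∉X with X g in g∈X
  ... | false = refl
  ... | true  = ⊥-elim (true≢false (trans (≡-sym (complete g g g∈Q g∈X)) (irrefl G g)))
  reorder : (λ u → (Q ─ g) u ∨ X u) ≗ ((λ u → Q u ∨ X u) ─ g)
  reorder u with u ≟ g
  ... | no _     = trans (cong (_∨ X u) (∧-identityʳ (Q u))) (≡-sym (∧-identityʳ _))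
  ... | yes refl = trans (cong (_∨ X u) (∧-zeroʳ (Q u))) (trans g∉X (≡-sym (∧-zeroʳ _)))

-- Isomorphisms and one-vertex extensions

≅-trans : ∀ {F G H} → F ≅ G → G ≅ H → F ≅ H
≅-trans φ ψ = record
  { bij      = ↔-trans (_≅_.bij φ) (_≅_.bij ψ)
  ; preserve = λ i j → trans (_≅_.preserve ψ _ _) (_≅_.preserve φ i j)
  }

InducedOn⇒≅ : ∀ {H K G P} → InducedOn H K P → (σ : V K → V G) (τ : V G → V K) →
              (∀ x → P (τ x) ≡ true) → (∀ x → σ (τ x) ≡ x) → (∀ u → P u ≡ true → τ (σ u) ≡ u) →
              (∀ u v → P u ≡ true → P v ≡ true → adj G (σ u) (σ v) ≡ adj K u v) → H ≅ G
InducedOn⇒≅ {H} {K} {G} {P} E σ τ τ-∈ στ τσ σ-adj = record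
  { bij      = mk↔ₛ′ to from to∘from from∘to
  ; preserve = λ i j → trans (σ-adj (ι i) (ι j) (ι-∈ i) (ι-∈ j)) (≡-sym (ι-adj i j))
  }
  where
  open InducedOn E
  to : V H → V G
  to i = σ (ι i)
  from : V G → V H
  from x = proj₁ (ι-onto (τ x) (τ-∈ x))
  to∘from : ∀ x → to (from x) ≡ x
  to∘from x = trans (cong σ (proj₂ (ι-onto (τ x) (τ-∈ x)))) (στ x)
  from∘to : ∀ i → from (to i) ≡ i
  from∘to i = ι-injective _ _ (trans (proj₂ (ι-onto (τ (to i)) (τ-∈ _))) (τσ (ι i) (ι-∈ i)))

addVertex : (G : Graph) → (V G → Bool) → Graph
addVertex G c = record { size = suc (size G) ; adj = A ; sym = A-sym ; irrefl = A-irrefl }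
  where
  A : Fin (suc (size G)) → Fin (suc (size G)) → Bool
  A zero    zero    = false
  A zero    (suc v) = c v
  A (suc u) zero    = c u
  A (suc u) (suc v) = adj G u v
  A-sym : ∀ i j → A i j ≡ A j i
  A-sym zero    zero    = refl
  A-sym zero    (suc v) = refl
  A-sym (suc u) zero    = refl
  A-sym (suc u) (suc v) = sym G u v
  A-irrefl : ∀ i → A i i ≡ false
  A-irrefl zero    = refl
  A-irrefl (suc u) = irrefl G u

shift : ∀ {n} → (Fin n → Bool) → Fin (suc n) → Bool
shift P zero    = false
shift P (suc u) = P u

InducedOn-addVertex : ∀ {H G P} (c : V G → Bool) → InducedOn H G P → InducedOn H (addVertex G c) (shift P)
InducedOn-addVertex {H} {G} {P} c E = record
  { ι           = suc ∘ ι
  ; ι-injective = λ i j e → ι-injective i j (suc-injective e)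
  ; ι-adj       = ι-adj
  ; ι-∈         = ι-∈
  ; ι-onto      = onto
  }
  where
  open InducedOn E
  onto : ∀ x → shift P x ≡ true → Σ (V H) λ i → suc (ι i) ≡ x
  onto (suc y) y∈P with ι-onto y y∈P
  ... | i , refl = i , refl

-- An s-dismantlable edge deletion as two vertex moves

module EdgeDeletionByVertexMoves (G : Graph) (g g' : V G) (g~g' : adj G g g' ≡ true) where

  g≢g' : g ≢ g'
  g≢g' refl = true≢false (trans (≡-sym g~g') (irrefl G g))

  clone : V G → Bool
  clone u = (⌊ u ≟ g ⌋ ∨ adj G g u) ∧ not ⌊ u ≟ g' ⌋

  clone-g : clone g ≡ true
  clone-g = cong₂ _∧_ (∨-introˡ (≟-refl g)) (cong not (≟-≢ g≢g'))

  clone-intro : ∀ {u} → adj G g u ≡ true → u ≢ g' → clone u ≡ true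
  clone-intro g~u u≢g' = cong₂ _∧_ (∨-introʳ g~u) (cong not (≟-≢ u≢g'))

  G⁺ : Graph
  G⁺ = addVertex G clone

  collapse : V G⁺ → V G
  collapse zero    = g
  collapse (suc u) = u

  clone-removable : VertexDel G⁺ G
  clone-removable =
    zero ,
    set⇒dismantlable (cone-dismantlable (suc g) clone-g apex) (induced-InducedOn G⁺ (adj G⁺ zero)) ,
    InducedOn⇒≅ (induced-InducedOn G⁺ ((λ _ → true) ─ zero)) collapse suc (λ _ → refl) (λ _ → refl) suc∘collapse
                (λ { (suc u) (suc v) _ _ → refl })
    where
    apex : ∀ u → adj G⁺ zero u ≡ true → u ≢ suc g → adj G⁺ (suc g) u ≡ true
    apex zero    _         _   = clone-g
    apex (suc y) y∈clone y≢g with ∨-true⁻ (proj₁ (∧-true⁻ y∈clone))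
    ... | inj₁ y≡g = ⊥-elim (y≢g (cong suc (≟-sound y≡g)))
    ... | inj₂ g~y = g~y
    suc∘collapse : ∀ u → not ⌊ u ≟ zero ⌋ ≡ true → suc (collapse u) ≡ u
    suc∘collapse (suc u) _ = refl

  common : V G → Bool
  common u = adj G g u ∧ adj G g' u

  poles : V G⁺ → Bool
  poles zero    = true
  poles (suc u) = ⌊ u ≟ g' ⌋

  Suspension : V G⁺ → Bool
  Suspension u = shift common u ∨ poles u

  Suspension-dismantlable : Dismantlable (N∩ G g g') → DismantlableSet G⁺ Suspension
  Suspension-dismantlable D =
    join-dismantlable (dismantlable⇒set D (InducedOn-addVertex clone (induced-InducedOn G common))) complete
    where
    complete : ∀ u v → shift common u ≡ true → poles v ≡ true → adj G⁺ u v ≡ true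
    complete (suc y) zero    y∈common _ with ∧-true⁻ y∈common
    ... | g~y , g'~y = clone-intro g~y λ { refl → true≢false (trans (≡-sym g'~y) (irrefl G y)) }
    complete (suc y) (suc z) y∈common z≡g' rewrite ≟-sound z≡g' = trans (sym G y g') (proj₂ (∧-true⁻ y∈common))

  Suspension⊆N : ∀ u → Suspension u ≡ true → adj G⁺ (suc g) u ≡ true
  Suspension⊆N zero    _ = clone-g
  Suspension⊆N (suc y) p with ∨-true⁻ p
  ... | inj₁ y∈common = proj₁ (∧-true⁻ y∈common)
  ... | inj₂ y≡g'     rewrite ≟-sound y≡g' = g~g'

  clone-dominates : ∀ u → adj G⁺ (suc g) u ≡ true → Suspension u ≡ false →
                    DominatedWithin G⁺ (adj G⁺ (suc g)) u zero
  clone-dominates zero    _   ()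
  clone-dominates (suc y) g~y outside zero    _   _ = inj₁ refl
  clone-dominates (suc y) g~y outside (suc z) g~z c = inj₂ (clone-intro g~z (z≢g' c))
    where
    z≢g' : InClosedN G⁺ (suc y) (suc z) → z ≢ g'
    z≢g' (inj₁ z≡y)  refl = true≢false (trans (≡-sym (∨-introʳ (≟-≡ (≡-sym (suc-injective z≡y))))) outside)
    z≢g' (inj₂ y~g') refl = true≢false (trans (≡-sym (∨-introˡ (cong₂ _∧_ g~y (trans (sym G g' y) y~g')))) outside)

  original-removable : Dismantlable (N∩ G g g') → VertexDel G⁺ (deleteEdge G g g')
  original-removable D =
    suc g ,
    set⇒dismantlable (absorb-dominated zero refl Suspension⊆N clone-dominates (Suspension-dismantlable D))
                     (induced-InducedOn G⁺ (adj G⁺ (suc g))) ,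
    InducedOn⇒≅ (induced-InducedOn G⁺ ((λ _ → true) ─ suc g)) collapse τ τ-∈ collapse∘τ τ∘collapse collapse-adj
    where
    τ : V G → V G⁺
    τ x with x ≟ g
    ... | yes _ = zero
    ... | no _  = suc x
    τ-∈ : ∀ x → not ⌊ τ x ≟ suc g ⌋ ≡ true
    τ-∈ x with x ≟ g
    ... | yes _   = refl
    ... | no x≢g  = cong not (trans (≟-suc x g) (≟-≢ x≢g))
    collapse∘τ : ∀ x → collapse (τ x) ≡ x
    collapse∘τ x with x ≟ g
    ... | yes x≡g = ≡-sym x≡g
    ... | no _    = refl
    ≢-deleted : ∀ {y} → not ⌊ suc y ≟ suc g ⌋ ≡ true → y ≢ g
    ≢-deleted {y} p = proj₂ (─-elim (λ _ → true) g (trans (cong not (≡-sym (≟-suc y g))) p))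
    τ∘collapse : ∀ u → not ⌊ u ≟ suc g ⌋ ≡ true → τ (collapse u) ≡ u
    τ∘collapse zero    _ with g ≟ g
    ... | yes _   = refl
    ... | no g≢g  = ⊥-elim (g≢g refl)
    τ∘collapse (suc y) p = τ-of-≢ (≢-deleted p)
      where
      τ-of-≢ : y ≢ g → τ y ≡ suc y
      τ-of-≢ y≢g with y ≟ g
      ... | yes y≡g = ⊥-elim (y≢g y≡g)
      ... | no _    = refl
    collapse-adj : ∀ u v → not ⌊ u ≟ suc g ⌋ ≡ true → not ⌊ v ≟ suc g ⌋ ≡ true →
                   adj (deleteEdge G g g') (collapse u) (collapse v) ≡ adj G⁺ u v
    collapse-adj zero    zero    _ _ rewrite irrefl G g = refl
    collapse-adj zero    (suc v) _ p
      rewrite ≟-refl g | ≟-≢ g≢g' | ≟-≢ (≢-deleted p) | ∨-identityʳ ⌊ v ≟ g' ⌋ = refl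
    collapse-adj (suc u) zero    p _
      rewrite ≟-refl g | ≟-≢ g≢g' | ≟-≢ (≢-deleted p) | ∧-identityʳ ⌊ u ≟ g' ⌋ | sym G u g = refl
    collapse-adj (suc u) (suc v) p q
      rewrite ≟-≢ (≢-deleted p) | ≟-≢ (≢-deleted q) | ∧-zeroʳ ⌊ u ≟ g' ⌋ = ∧-identityʳ _

VertexDel-≅ : ∀ {F G H} → VertexDel F G → G ≅ H → VertexDel F H
VertexDel-≅ (v , v-dism , F-v≅G) G≅H = v , v-dism , ≅-trans F-v≅G G≅H

EdgeDel⇒SameS : ∀ {G H} → EdgeDel G H → SameS G H
EdgeDel⇒SameS {G} {H} (g , g' , (g~g' , _ , D) , G-gg'≅H) =
  add-clone ◅ delete-original ◅ ε
  where
  open EdgeDeletionByVertexMoves G g g' g~g'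
  add-clone : SymClosure SMove G G⁺
  add-clone = bwd (inj₂ clone-removable)
  delete-original : SymClosure SMove G⁺ H
  delete-original = fwd (inj₂ (VertexDel-≅ {F = G⁺} (original-removable D) G-gg'≅H))

WSMove⇒SameS : WSMove ⇒ SameS
WSMove⇒SameS (inj₁ G≅H)        = fwd (inj₁ G≅H) ◅ ε
WSMove⇒SameS (inj₂ (inj₁ del)) = fwd (inj₂ del) ◅ ε
WSMove⇒SameS (inj₂ (inj₂ del)) = EdgeDel⇒SameS del

SMove⇒WSMove : SMove ⇒ WSMove
SMove⇒WSMove (inj₁ G≅H) = inj₁ G≅H
SMove⇒WSMove (inj₂ del) = inj₂ (inj₁ del)

proposition4p3 : (G H : Graph) → (SameS G H → SameWS G H) × (SameWS G H → SameS G H)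
proposition4p3 _ _ = EqClosure.map SMove⇒WSMove , EqClosure.fold (EqClosure.isEquivalence SMove) WSMove⇒SameS
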